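{- Let $\mathbb{F}$ be an infinite field of characteristic $0$ and let $n$ be a positive integer. Then the algebra $(\mathcal{M}_n(\mathbb{F}),\mathbb{F},+_\mathbb{F},|\ast|)$ is not an $\vec{e}$-Ramsey algebra for any nonconstant $\vec{e}\in\Omega_0$.
   Context: An algebra is a pair $(\{A_\xi\}_{\xi\in I},\mathcal{F})$ with nonempty, pairwise disjoint phyla and a family $\mathcal{F}$ of operations, each with domain a finite product of phyla and codomain a phylum. A sort is $\vec{e}\in{}^\omega I$, and $\vec{b}$ is $\vec{e}$-sorted if $\vec{b}(i)\in A_{\vec{e}(i)}$ for all $i$. Orderly terms: $\mathcal{F}_0=\mathcal{F}\cup\{\mathrm{id}_{A_\xi}\}$. $\mathcal{F}_{k+1}$ is $\mathcal{F}_k$ plus all $f$ with $f(\vec{x})=g(h_1(\vec{x}_1),\dots,h_N(\vec{x}_N))$, where $g\in\mathcal{F}$ is $N$-ary, $h_i\in\mathcal{F}_k$, and $\vec{x}_1\ast\cdots\ast\vec{x}_N=\vec{x}$ is the argument list of $f$ (concatenation). $\mathrm{OT}(\mathcal{F})=\bigcup_k\mathcal{F}_k$. $\vec{a}\le_\mathcal{F}\vec{b}$ means: for each $j$ there are a finite subsequence $\vec{b}_j$ of $\vec{b}$ and $f_j\in\mathrm{OT}(\mathcal{F})$ with $\vec{a}(j)=f_j(\vec{b}_j)$, and $\vec{b}_0\ast\vec{b}_1\ast\cdots$ is a subsequence of $\vec{b}$. $\mathrm{FR}^{\vec{e}}_\mathcal{F}(\vec{b})=\{\vec{a}(0):\vec{a}\le_\mathcal{F}\vec{b},\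 \vec{a}\ \vec{e}\text{ -sorted}\}$. $\vec{e}$-Ramsey algebra: for every $\vec{e}$-sorted $\vec{b}$ and $X\subseteq A_{\vec{e}(0)}$ some $\vec{e}$-sorted $\vec{a}\le_\mathcal{F}\vec{b}$ has $\mathrm{FR}^{\vec{e}}_\mathcal{F}(\vec{a})\subseteq X$ or disjoint from $X$. $\Omega$ is the set of sorts each of whose values is taken infinitely often, and $\Omega_0=\{\vec{e}\in\Omega:\vec{e}(0)=0\}$. The phyla are $A_0=\mathbb{F}$ (index $0$) and $A_1=\mathcal{M}_n(\mathbb{F})$ of $n\times n$ matrices over $\mathbb{F}$ (index $1$), regarded as disjoint. The operations are field addition $+_\mathbb{F}$ and the determinant $|\ast|:\mathcal{M}_n(\mathbb{F})\to\mathbb{F}$. -}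

module Defs where

open import Level using (Level; _⊔_) renaming (suc to lsuc)
open import Data.Nat using (ℕ; zero; suc; _<_; _≤_)
open import Data.Fin using (Fin; punchIn) renaming (zero to fz; suc to fs)
open import Data.List using (List; []; _∷_; _++_; map)
open import Data.List.Membership.Propositional using (_∈_)
open import Data.List.Relation.Unary.Linked using (Linked)
open import Data.Product using (Σ; ∃; _×_; _,_)
open import Data.Sum using (_⊎_)
open import Relation.Binary.PropositionalEquality using (_≡_; _≢_)
open import Relation.Nullary using (¬_)
open import Algebra.Bundles using (CommutativeRing; Semiring)
import Algebra.Definitions.RawSemiring as RS

record Field (c ℓ : Level) : Set (lsuc (c ⊔ ℓ)) where
  field
    commutativeRing : CommutativeRing c ℓ
  open CommutativeRing commutativeRing public
  field
    1≉0     : ¬ (1# ≈ 0#)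
    inverse : ∀ x → ¬ (x ≈ 0#) → ∃ λ y → (x * y) ≈ 1#

module FieldProps {c ℓ} (F : Field c ℓ) where
  open Field F
  open RS (Semiring.rawSemiring semiring) using (sum) renaming (_×_ to _⋆_) public

  CharZero : Set ℓ
  CharZero = ∀ m → ¬ ((suc m ⋆ 1#) ≈ 0#)

  Infinite : Set (c ⊔ ℓ)
  Infinite = Σ (ℕ → Carrier) λ f → ∀ i j → f i ≈ f j → i ≡ j

  Mat : ℕ → Set c
  Mat n = Fin n → Fin n → Carrier

  sgn : ∀ {n} → Fin n → Carrier
  sgn fz     = 1#
  sgn (fs i) = - sgn i

  det : ∀ n → Mat n → Carrier
  det zero    M = 1#
  det (suc n) M = sum λ i → sgn i * (M i fz * det n (λ r s → M (punchIn i r) (fs s)))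

-- phylum indices: fld is index 0 (A₀ = F), mat is index 1 (A₁ = M_n(F))
data Phy : Set where
  fld mat : Phy

module DetAlgebra {c ℓ} (F : Field c ℓ) (n : ℕ) where
  open Field F
  open FieldProps F

  El : Phy → Set c
  El fld = Carrier
  El mat = Mat n

  EqEl : ∀ s → El s → El s → Set ℓ
  EqEl fld x y = x ≈ y
  EqEl mat A B = ∀ i j → A i j ≈ B i j

  data Args : List Phy → Set c where
    []  : Args []
    _∷_ : ∀ {s ss} → El s → Args ss → Args (s ∷ ss)

  split : ∀ xs {ys} → Args (xs ++ ys) → Args xs × Args ys
  split []       as       = [] , as
  split (x ∷ xs) (a ∷ as) with split xs as
  ... | (l , r) = (a ∷ l) , r

  -- orderly terms OT(F), indexed by argument sort list and output sort.
  -- F₀ = F ∪ {id}; each step applies an operation g ∈ F = {+, det}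
  -- to terms whose argument lists are concatenated.
  data OT : List Phy → Phy → Set where
    idT  : ∀ s → OT (s ∷ []) s
    plus : ∀ {xs ys} → OT xs fld → OT ys fld → OT (xs ++ ys) fld
    detT : ∀ {xs} → OT xs mat → OT xs fld

  eval : ∀ {ss s} → OT ss s → Args ss → El s
  eval (idT s)          (a ∷ []) = a
  eval (plus {xs} t u)  as with split xs as
  ... | (l , r) = eval t l + eval u r
  eval (detT t)         as = det n (eval t as)

  Sort : Set
  Sort = ℕ → Phy

  Seq : Sort → Set c
  Seq e = (i : ℕ) → El (e i)

  pick : ∀ {e} → Seq e → (is : List ℕ) → Args (map e is)
  pick b []       = []
  pick b (i ∷ is) = b i ∷ pick b is

  -- a family of finite index lists whose concatenation idx 0 ∗ idx 1 ∗ ⋯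
  -- is strictly increasing, i.e. describes a subsequence of b
  IsBlocks : (ℕ → List ℕ) → Set
  IsBlocks idx = (∀ j → Linked _<_ (idx j))
               × (∀ j j' x y → j < j' → x ∈ idx j → y ∈ idx j' → x < y)

  Reduct : ∀ e' e → Seq e' → Seq e → Set ℓ
  Reduct e' e a b =
    Σ (ℕ → List ℕ) λ idx → IsBlocks idx ×
      Σ ((j : ℕ) → OT (map e (idx j)) (e' j)) λ f →
        ∀ j → EqEl (e' j) (a j) (eval (f j) (pick {e} b (idx j)))

  InFR : (e : Sort) → Seq e → El (e 0) → Set (c ⊔ ℓ)
  InFR e b x = Σ (Seq e) λ a → Reduct e e a b × EqEl (e 0) (a 0) x

  Respects : ∀ s → (El s → Set ℓ) → Set (c ⊔ ℓ)
  Respects s X = ∀ (x y : El s) → EqEl s x y → X x → X y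

  IsRamsey : Sort → Set (c ⊔ lsuc ℓ)
  IsRamsey e = (b : Seq e) (X : El (e 0) → Set ℓ) → Respects (e 0) X →
    Σ (Seq e) λ a → Reduct e e a b ×
      ((∀ x → InFR e a x → X x) ⊎ (∀ x → InFR e a x → ¬ X x))

-- Ω: every value taken by e is taken infinitely often; Ω₀: also e 0 = index 0
InΩ : (ℕ → Phy) → Set
InΩ e = ∀ i m → Σ ℕ λ k → (m ≤ k) × (e k ≡ e i)

InΩ₀ : (ℕ → Phy) → Set
InΩ₀ e = InΩ e × (e 0 ≡ fld)

Nonconstant : (ℕ → Phy) → Set
Nonconstant e = Σ ℕ λ i → Σ ℕ λ j → e i ≢ e j

-- Since e is nonconstant with e 0 = fld, the matrix phylum occurs in e, and
-- (e ∈ Ω) at two positions k < k'.  Colour the field by X = {1} and take the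
-- sequence b carrying 0 in every field position and the identity matrix I in
-- every matrix position.  The only orderly terms of matrix sort are the
-- identity terms, so every reduct a ≤_F b again has I in all its matrix
-- positions.  By the splicing lemma (any orderly term applied to an increasing
-- list of entries of a starts some reduct of a, because every phylum recurs in
-- e) both  |a k| = 1 ∈ X  and  |a k| + |a k'| = 1 + 1 ∉ X  lie in FR^e(a), so
-- FR^e(a) is neither inside X nor disjoint from it.
module Submission where

open import Defs
open import Level using (Level; Lift; lift)
open import Data.Unit using (⊤)
open import Data.Nat using (ℕ; zero; suc; _≤_; _<_; s≤s)
open import Data.Nat.Properties using (<-trans; ≤-<-trans; m≤n⇒m<n∨m≡n)
open import Data.Fin using (Fin; punchIn) renaming (zero to fz; suc to fs)
open import Data.List using (List; []; _∷_; map)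
open import Data.List.Membership.Propositional using (_∈_)
open import Data.List.Relation.Unary.Any using (here)
open import Data.List.Relation.Unary.All using (lookup)
open import Data.List.Relation.Unary.Linked using (Linked; [-]; _∷_)
open import Data.List.Extrema.Nat using (max; xs≤max)
open import Data.Product using (Σ; _×_; _,_; proj₁; proj₂)
open import Data.Sum using (inj₁; inj₂)
open import Data.Empty using (⊥-elim)
open import Relation.Binary.PropositionalEquality using (_≡_; refl; trans)
open import Relation.Nullary using (¬_)
import Algebra.Properties.Monoid.Sum as MonoidSum
import Algebra.Properties.Ring as RingProperties

matrixPosition : (e : ℕ → Phy) → Nonconstant e → Σ ℕ λ k → e k ≡ mat
matrixPosition e (i , j , eᵢ≢eⱼ) with e i in eᵢ≡ | e j in eⱼ≡
... | mat | _   = i , eᵢ≡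
... | fld | mat = j , eⱼ≡
... | fld | fld = ⊥-elim (eᵢ≢eⱼ refl)

step⇒strictlyIncreasing : (g : ℕ → ℕ) → (∀ j → g j < g (suc j)) →
                          ∀ {j j'} → j < j' → g j < g j'
step⇒strictlyIncreasing g step {j} {suc j'} (s≤s j≤j') with m≤n⇒m<n∨m≡n j≤j'
... | inj₁ j<j' = <-trans (step⇒strictlyIncreasing g step j<j') (step j')
... | inj₂ refl = step j

module Determinants {c ℓ} (F : Field c ℓ) where
  open Field F renaming (refl to ≈-refl; trans to ≈-trans)
  open FieldProps F
  open MonoidSum +-monoid using (sum-cong-≋; sum-replicate-zero)

  sum-cong : ∀ m {f g : Fin m → Carrier} → (∀ i → f i ≈ g i) → sum f ≈ sum g
  sum-cong m = sum-cong-≋ {m}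

  I : ∀ {m} → Mat m
  I fz     fz     = 1#
  I fz     (fs _) = 0#
  I (fs _) fz     = 0#
  I (fs i) (fs j) = I i j

  det-cong : ∀ m {A B : Mat m} → (∀ i j → A i j ≈ B i j) → det m A ≈ det m B
  det-cong zero    A≈B = ≈-refl
  det-cong (suc m) A≈B = sum-cong (suc m) λ i →
    *-congˡ {sgn i} (*-cong (A≈B i fz) (det-cong m λ r s → A≈B (punchIn i r) (fs s)))

  -- |I| = 1: only the first term of the expansion survives, and its minor is I.
  det-I : ∀ m → det m I ≈ 1#
  det-I zero    = ≈-refl
  det-I (suc m) = ≈-trans (+-cong first-term below-diagonal) (+-identityʳ 1#)
    where
    first-term : sgn {suc m} fz * (1# * det m I) ≈ 1#
    first-term = ≈-trans (*-identityˡ (1# * det m I)) (≈-trans (*-identityˡ (det m I)) (det-I m))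
    minor : Fin m → Mat m
    minor i r s = I (punchIn (fs i) r) (fs s)
    below-diagonal : sum (λ i → sgn (fs i) * (0# * det m (minor i))) ≈ 0#
    below-diagonal = ≈-trans
      (sum-cong m λ i → ≈-trans (*-congˡ {sgn (fs i)} (zeroˡ _)) (zeroʳ _))
      (sum-replicate-zero m)

  1+1≉1 : ¬ (1# + 1# ≈ 1#)
  1+1≉1 eq = 1≉0 (RingProperties.x+x≈x⇒x≈0 ring 1# eq)

module NotRamsey {c ℓ} (F : Field c ℓ) (n : ℕ) where
  open Field F renaming (refl to ≈-refl; sym to ≈-sym; trans to ≈-trans)
  open FieldProps F
  open DetAlgebra F n
  open Determinants F

  ≈ₑ-refl : ∀ s (x : El s) → EqEl s x x
  ≈ₑ-refl fld x     = ≈-refl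
  ≈ₑ-refl mat A i j = ≈-refl

  idTerm : ∀ {s s'} → s ≡ s' → OT (s ∷ []) s'
  idTerm {s} refl = idT s

  -- If every phylum recurs in e, the value of an orderly term t
  -- on an increasing list L of positions of a lies in FR^e(a): use L as the
  -- first block and, for every j ≥ 1, a single later position of phylum e j.
  term∈FR : (e : Sort) → InΩ e → (a : Seq e) (L : List ℕ) → Linked _<_ L →
            (t : OT (map e L) (e 0)) → InFR e a (eval t (pick a L))
  term∈FR e recurs a L L↑ t =
    reduct , (blocks , (blocks↑ , ordered) , terms , λ j → ≈ₑ-refl (e j) _) , ≈ₑ-refl (e 0) _
    where
    -- pos (suc j) is a position of phylum e (suc j) beyond pos j; pos 0 bounds L
    pos : ℕ → ℕ
    pos zero    = max 0 L
    pos (suc j) = proj₁ (recurs (suc j) (suc (pos j)))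

    pos-step : ∀ j → pos j < pos (suc j)
    pos-step j = proj₁ (proj₂ (recurs (suc j) (suc (pos j))))

    blocks : ℕ → List ℕ
    blocks zero    = L
    blocks (suc j) = pos (suc j) ∷ []

    terms : (j : ℕ) → OT (map e (blocks j)) (e j)
    terms zero    = t
    terms (suc j) = idTerm (proj₂ (proj₂ (recurs (suc j) (suc (pos j)))))

    reduct : Seq e
    reduct j = eval (terms j) (pick a (blocks j))

    blocks↑ : ∀ j → Linked _<_ (blocks j)
    blocks↑ zero    = L↑
    blocks↑ (suc j) = [-]

    ordered : ∀ j j' x y → j < j' → x ∈ blocks j → y ∈ blocks j' → x < y
    ordered zero    (suc j') x y j<j' x∈L (here refl) =
      ≤-<-trans (lookup (xs≤max 0 L) x∈L) (step⇒strictlyIncreasing pos pos-step j<j')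
    ordered (suc j) (suc j') x y j<j' (here refl) (here refl) =
      step⇒strictlyIncreasing pos pos-step j<j'

  IsOne : ∀ s → El s → Set ℓ
  IsOne fld x = x ≈ 1#
  IsOne mat A = ∀ i j → A i j ≈ I i j

  IsOne-respects : ∀ s → Respects s (IsOne s)
  IsOne-respects fld x y x≈y x≈1     = ≈-trans (≈-sym x≈y) x≈1
  IsOne-respects mat A B A≈B A≈I i j = ≈-trans (≈-sym (A≈B i j)) (A≈I i j)

  -- The invariant shared by b and all its reducts: matrices are the identity.
  OneIfMatrix : ∀ s → El s → Set ℓ
  OneIfMatrix fld _ = Lift ℓ ⊤
  OneIfMatrix mat A = IsOne mat A

  OneIfMatrix-respects : ∀ s (x y : El s) → EqEl s x y → OneIfMatrix s y → OneIfMatrix s x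
  OneIfMatrix-respects fld x y _   _ = lift _
  OneIfMatrix-respects mat A B A≈B B≈I = IsOne-respects mat B A (λ i j → ≈-sym (A≈B i j)) B≈I

  AllOneIfMatrix : ∀ {ss} → Args ss → Set ℓ
  AllOneIfMatrix []       = Lift ℓ ⊤
  AllOneIfMatrix (_∷_ {s} x xs) = OneIfMatrix s x × AllOneIfMatrix xs

  -- Rigidity: an orderly term of matrix sort is an identity term, so terms
  -- preserve the invariant.
  eval-OneIfMatrix : ∀ {ss s} (t : OT ss s) (xs : Args ss) → AllOneIfMatrix xs →
                     OneIfMatrix s (eval t xs)
  eval-OneIfMatrix (idT fld)  _        _         = lift _
  eval-OneIfMatrix (idT mat)  (A ∷ []) (A≈I , _) = A≈I
  eval-OneIfMatrix (plus t u) _        _         = lift _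
  eval-OneIfMatrix (detT t)   _        _         = lift _

  unit : ∀ s → El s
  unit fld = 0#
  unit mat = I

  unit-OneIfMatrix : ∀ s → OneIfMatrix s (unit s)
  unit-OneIfMatrix fld     = lift _
  unit-OneIfMatrix mat i j = ≈-refl

  unitSeq : (e : Sort) → Seq e
  unitSeq e i = unit (e i)

  pick-unitSeq : ∀ e (L : List ℕ) → AllOneIfMatrix (pick {e} (unitSeq e) L)
  pick-unitSeq e []      = lift _
  pick-unitSeq e (i ∷ L) = unit-OneIfMatrix (e i) , pick-unitSeq e L

  reduct-rigid : ∀ e (a : Seq e) → Reduct e e a (unitSeq e) → ∀ m → OneIfMatrix (e m) (a m)
  reduct-rigid e a (blocks , _ , terms , a≈) m =
    OneIfMatrix-respects (e m) (a m) _ (a≈ m)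
      (eval-OneIfMatrix (terms m) _ (pick-unitSeq e (blocks m)))

  det-IsOne : ∀ A → IsOne mat A → det n A ≈ 1#
  det-IsOne A A≈I = ≈-trans (det-cong n A≈I) (det-I n)

  detTerm : ∀ {s₀ s} → s₀ ≡ fld → s ≡ mat →
            Σ (OT (s ∷ []) s₀) λ t → ∀ A → OneIfMatrix s A → IsOne s₀ (eval t (A ∷ []))
  detTerm refl refl = detT (idT mat) , det-IsOne

  detSumTerm : ∀ {s₀ s s'} → s₀ ≡ fld → s ≡ mat → s' ≡ mat →
               Σ (OT (s ∷ s' ∷ []) s₀) λ t →
                 ∀ A B → OneIfMatrix s A → OneIfMatrix s' B → ¬ IsOne s₀ (eval t (A ∷ B ∷ []))
  detSumTerm refl refl refl = plus (detT (idT mat)) (detT (idT mat)) , λ A B A≈I B≈I sum≈1 →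
    1+1≉1 (≈-trans (≈-sym (+-cong (det-IsOne A A≈I) (det-IsOne B B≈I))) sum≈1)

  notRamsey : (e : Sort) → InΩ e → e 0 ≡ fld → (k : ℕ) → e k ≡ mat → ¬ IsRamsey e
  notRamsey e recurs e₀ k eₖ ramsey
    with ramsey (unitSeq e) (IsOne (e 0)) (IsOne-respects (e 0))
  ... | a , a≤b , inj₁ FR⊆X =
    let t , 1+1∉X = detSumTerm e₀ eₖ eₖ'
    in 1+1∉X (a k) (a k') (rigid k) (rigid k')
             (FR⊆X _ (term∈FR e recurs a (k ∷ k' ∷ []) (k<k' ∷ [-]) t))
    where
    rigid : ∀ m → OneIfMatrix (e m) (a m)
    rigid = reduct-rigid e a a≤b
    -- a second matrix position after k, since phyla recur in e
    k' : ℕ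
    k' = proj₁ (recurs k (suc k))
    k<k' : k < k'
    k<k' = proj₁ (proj₂ (recurs k (suc k)))
    eₖ' : e k' ≡ mat
    eₖ' = trans (proj₂ (proj₂ (recurs k (suc k)))) eₖ
  ... | a , a≤b , inj₂ FR∩X=∅ =
    let t , 1∈X = detTerm e₀ eₖ
    in FR∩X=∅ _ (term∈FR e recurs a (k ∷ []) [-] t) (1∈X (a k) (reduct-rigid e a a≤b k))

mainTheorem15 : ∀ {c ℓ : Level} (F : Field c ℓ) → FieldProps.Infinite F → FieldProps.CharZero F →
    (n : ℕ) → 1 ≤ n → (e : ℕ → Phy) → InΩ₀ e → Nonconstant e →
    ¬ DetAlgebra.IsRamsey F n e
mainTheorem15 F _ _ n _ e (recurs , e₀) nonconstant =
  let k , eₖ = matrixPosition e nonconstant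
  in NotRamsey.notRamsey F n e recurs e₀ k eₖ
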